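{- For integers $s\ge 2$ define $c_{2,0}(s)=27\cdot 9^{s-3}-1$, $c_{2,1}(s)=24(2s-3)\,9^{s-3}$, and $c_{2,2}(s)=81\cdot 81^{s-3}-3\cdot 9^{s-3}$. Then for every $s\ge 2$ the entry in row $2$, column $s$ of the one-variable circuit array is $$C^X_{2,s}=\frac{c_{2,0}(s)-c_{2,1}(s)\,X+c_{2,2}(s)\,X^2}{\left(9^{s-2}X-1\right)^2}.$$
   Context: An $n$-grid is a graph isomorphic to the graph whose vertices are the integer points $(2r+s,s)$ with $0\le r\le n$, $0\le s\le n-r$, two vertices $(x,y),(x',y')$ being adjacent iff $(x'-x,y'-y)\in\{(1,1),(2,0),(1,-1)\}$. Its upright unit triangles are indexed $T_{r,d}$, where $r=1,\dots,n$ is the row counted from the apex downward and $d=1,\dots,r$ is the position within the row counted from the left. Each upright triangle has a left edge $L$, a right edge $R$ and a base edge $B$, and $T_{r,d,e}$ ($e\in\{L,R,B\}$) denotes the label (resistance) on that edge. Every edge of the grid is an edge of exactly one upright triangle. Row reduction turns a labelled $n$-grid into a labelled $(n-1)$-grid: (1) replace each upright triangle by a star (Δ–Y transform), the spoke at the vertex shared by triangle edges $x,y$ having label $\Delta(x,y,z)=xy/(x+y+z)$, where $z$ is the third edge; (2) delete the spokes at the three corner vertices of the grid; (3) combine each pair of consecutive spokes meeting at a remaining boundary vertex of degree two into one edge whose label is their sum (series rule); (4) replace each remaining star (spokes $a,b,c$) by a triangle (Y–Δ transform), the edge opposite spoke $a$ having label $Y(a,b,c)=(ab+bc+ca)/a$.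 The result is an $(n-1)$-grid whose vertices are the centres of the parent's upright triangles, embedded naturally. $T^m_{r,d,e}$ denotes labels after $m$ reductions. Start from the all-one $n$-grid (every edge labelled $1$). After one reduction every boundary edge has label $2/3$ and every other edge label $1$. The one-variable circuit array $C^X$ is obtained by instead labelling every boundary edge of this once-reduced grid by $(X-3)/X$, $X$ an indeterminate (other edges label $1$), and performing all further reductions symbolically. For $j\ge1$ and $0\le i\le 2(j-1)$, $C^X_{i,j}$ is the label $T^j_{2j-1,\,j-\lfloor (i+1)/2\rfloor,\,e}$ after $j$ reductions in total, with $e=L$ for $i$ even and $e=R$ for $i$ odd, for $n$ large enough (e.g. $n\ge 4j-2$), where it is independent of $n$. -}

module Defs where

open import Data.Nat as ℕ using (ℕ; zero; suc; _≡ᵇ_; _∸_)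
open import Data.Integer as ℤ using (ℤ)
open import Data.Rational as ℚ using (ℚ; 0ℚ; 1ℚ)
open import Data.List using (List; []; _∷_; map)
open import Data.List.Relation.Unary.All using (All)
open import Data.Bool using (if_then_else_)
open import Relation.Binary.PropositionalEquality using (_≡_)

-- Polynomials in one indeterminate X with rational coefficients
-- (coefficient lists, lowest degree first; trailing zeros allowed).

Poly : Set
Poly = List ℚ

infixl 6 _+P_
infixl 7 _*P_

_+P_ : Poly → Poly → Poly
[]      +P q       = q
(a ∷ p) +P []      = a ∷ p
(a ∷ p) +P (b ∷ q) = (a ℚ.+ b) ∷ (p +P q)

scaleP : ℚ → Poly → Poly
scaleP a = map (a ℚ.*_)

negP : Poly → Poly
negP = map (λ a → ℚ.- a)

_*P_ : Poly → Poly → Poly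
[]      *P q = []
(a ∷ p) *P q = scaleP a q +P (0ℚ ∷ (p *P q))

constP : ℚ → Poly
constP a = a ∷ []

Xp : Poly
Xp = 0ℚ ∷ 1ℚ ∷ []

IsZeroP : Poly → Set
IsZeroP p = All (_≡ 0ℚ) p

infix 4 _≈P_
_≈P_ : Poly → Poly → Set
p ≈P q = IsZeroP (p +P negP q)

-- Rational functions in X as formal fractions num/den
-- (arithmetic of the field of fractions ℚ(X)).

record RatFun : Set where
  constructor _⁄_
  field
    num : Poly
    den : Poly
open RatFun public

infixl 6 _+R_
infixl 7 _*R_ _/R_

_+R_ : RatFun → RatFun → RatFun
(a ⁄ b) +R (c ⁄ d) = (a *P d +P c *P b) ⁄ (b *P d)

_*R_ : RatFun → RatFun → RatFun
(a ⁄ b) *R (c ⁄ d) = (a *P c) ⁄ (b *P d)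

_/R_ : RatFun → RatFun → RatFun
(a ⁄ b) /R (c ⁄ d) = (a *P d) ⁄ (b *P c)

oneR : RatFun
oneR = constP 1ℚ ⁄ constP 1ℚ

-- Δ(x,y,z) = xy/(x+y+z)   (Δ–Y transform)
ΔR : RatFun → RatFun → RatFun → RatFun
ΔR x y z = (x *R y) /R (x +R y +R z)

-- Y(a,b,c) = (ab+bc+ca)/a   (Y–Δ transform; edge opposite spoke a)
YR : RatFun → RatFun → RatFun → RatFun
YR a b c = (a *R b +R b *R c +R c *R a) /R a

-- Edge e ∈ {L,R,B} of the upright triangle T_{r,d}
-- (r = row from apex, d = position in row, both starting at 1).
-- A labelling of an n-grid is a function of (r , d , e); only the
-- values with 1 ≤ d ≤ r ≤ n are meaningful.

data Edge : Set where
  L R B : Edge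

Labelling : Set
Labelling = ℕ → ℕ → Edge → RatFun

module _ (T : Labelling) where
  -- spokes of the star replacing T_{r,d}
  apexS blS brS : ℕ → ℕ → RatFun
  apexS r d = ΔR (T r d L) (T r d R) (T r d B)   -- at apex (edges L,R)
  blS   r d = ΔR (T r d L) (T r d B) (T r d R)   -- at bottom-left (edges L,B)
  brS   r d = ΔR (T r d R) (T r d B) (T r d L)   -- at bottom-right (edges R,B)

-- One row reduction of a labelled n-grid, giving a labelled (n-1)-grid.
-- The new vertex c_{r,d} is the centre of the old T_{r,d}; the new
-- triangle T'_{r,d} has apex c_{r,d} and base c_{r+1,d}, c_{r+1,d+1}.
-- An interior old vertex (k,p) (1 ≤ k < n, 2 ≤ p ≤ k) carries the star
-- with spokes a = apexS(k+1,p), b = blS(k,p), c = brS(k,p-1), towards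
-- c_{k+1,p}, c_{k,p}, c_{k,p-1} respectively.  Degree-two boundary
-- vertices give series edges.
reduce : ℕ → Labelling → Labelling
reduce n T r d L =
  if d ≡ᵇ 1
  then blS T r 1 +R apexS T (suc r) 1                         -- left boundary vertex (r,1)
  else YR (brS T r (d ∸ 1)) (apexS T (suc r) d) (blS T r d)   -- vertex (r,d)
reduce n T r d R =
  if d ≡ᵇ r
  then brS T r r +R apexS T (suc r) (suc r)                   -- right boundary vertex (r,r+1)
  else YR (blS T r (suc d)) (apexS T (suc r) (suc d)) (brS T r d)  -- vertex (r,d+1)
reduce n T r d B =
  if suc r ≡ᵇ n
  then blS T n (suc d) +R brS T n d                           -- bottom boundary vertex (n,d+1)
  else YR (apexS T (suc (suc r)) (suc d)) (blS T (suc r) (suc d)) (brS T (suc r) d)  -- vertex (r+1,d+1)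

reduceN : ℕ → ℕ → Labelling → Labelling
reduceN n zero    T = T
reduceN n (suc m) T = reduceN (n ∸ 1) m (reduce n T)

bdryX : RatFun
bdryX = (constP (ℚ.- (ℤ.+ 3 ℚ./ 1)) +P (0ℚ ∷ 1ℚ ∷ [])) ⁄ Xp

-- The once-reduced all-one grid (an (n-1)-grid, n the original size)
-- with every boundary edge relabelled (X-3)/X and all other edges 1.
initX : ℕ → Labelling
initX n r d L = if d ≡ᵇ 1 then bdryX else oneR
initX n r d R = if d ≡ᵇ r then bdryX else oneR
initX n r d B = if r ≡ᵇ (n ∸ 1) then bdryX else oneR

-- C^X_{i,j} computed in an original n-grid: the label
-- T^j_{2j-1, j-⌊(i+1)/2⌋, e} after j reductions in total
-- (the first being the one producing initX, then j-1 symbolic ones).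
edgeOf : ℕ → Edge
edgeOf zero          = L
edgeOf (suc zero)    = R
edgeOf (suc (suc i)) = edgeOf i

CX : ℕ → ℕ → ℕ → RatFun
CX n i j = reduceN (n ∸ 1) (j ∸ 1) (initX n)
             (2 ℕ.* j ∸ 1) (j ∸ ℕ._/_ (suc i) 2) (edgeOf i)

-- Coefficients of Corollary 4.6 (9^{s-3} is rational for s = 2).

qℕ : ℕ → ℚ
qℕ k = ℤ.+ k ℚ./ 1

powℚ : ℚ → ℕ → ℚ
powℚ a zero    = 1ℚ
powℚ a (suc k) = a ℚ.* powℚ a k

nine^s-3 : ℕ → ℚ
nine^s-3 s = powℚ (qℕ 9) (s ∸ 2) ℚ.* (ℤ.+ 1 ℚ./ 9)

eightyone^s-3 : ℕ → ℚ
eightyone^s-3 s = powℚ (qℕ 81) (s ∸ 2) ℚ.* (ℤ.+ 1 ℚ./ 81)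

c20 c21 c22 : ℕ → ℚ
c20 s = qℕ 27 ℚ.* nine^s-3 s ℚ.- 1ℚ
c21 s = qℕ 24 ℚ.* (qℕ (2 ℕ.* s) ℚ.- qℕ 3) ℚ.* nine^s-3 s
c22 s = qℕ 81 ℚ.* eightyone^s-3 s ℚ.- qℕ 3 ℚ.* nine^s-3 s

numC2 : ℕ → Poly
numC2 s = c20 s ∷ ℚ.- c21 s ∷ c22 s ∷ []

denC2 : ℕ → Poly
denC2 s = let q = ℚ.- 1ℚ ∷ powℚ (qℕ 9) (s ∸ 2) ∷ [] in q *P q

-- Away from the bottom and right boundaries a row reduction does not see the row index, so
-- C^X_{2,s} is a label of the left wedge: the labelling of the positions d = 1, 2, ... next to
-- the left boundary, reduced s - 1 times.  After m reductions of the wedge, with q = 9^m X,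
-- column m + 1 carries L = (q - 3)/q and R = B = 1 while every column further right is still 1;
-- one more reduction turns column m + 1 into a corner with R = B = (9q - 3)/(9q - 9) and
-- L = N'/(9q - 9)^2, where N' = 9 (6 (q - 3)(q - 1) + 2 (q - 3)(q - 9) + N) for the previous
-- corner numerator N.  The numerator 81 (c20 - c21 X + c22 X^2) solves this recurrence.
-- The labels are formal fractions that are never cancelled, so all this is verified by
-- evaluating at rational points X > 3, where every label involved is positive; the resulting
-- polynomial identity holds on a half-line and hence coefficientwise.

module Submission where

open import Defs
open import Data.Rational using (ℚ)

module Polynomials where

  open import Data.Nat as ℕ using (suc; s≤s)
  import Data.Nat.Properties as ℕ
  open import Data.Rational using (ℚ; 0ℚ; 1ℚ; _+_; _*_; -_; _-_; _≤_; _<_; _≟_; NonZero; 1/_; positive)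
  open import Data.Rational.Properties
  open import Data.List using ([]; _∷_; length)
  open import Data.List.Relation.Unary.All using ([]; _∷_)
  open import Data.Maybe.Base using (Maybe; just; nothing)
  open import Relation.Nullary using (¬_; yes; no)
  open import Relation.Binary.PropositionalEquality
  open import Level using (0ℓ)
  open import Tactic.RingSolver.Core.AlmostCommutativeRing using (AlmostCommutativeRing; fromCommutativeRing)
  open import Tactic.RingSolver using (solve-∀)

  ℚ-ring : AlmostCommutativeRing 0ℓ 0ℓ
  ℚ-ring = fromCommutativeRing +-*-commutativeRing isZero
    where
    isZero : ∀ x → Maybe (0ℚ ≡ x)
    isZero x with 0ℚ ≟ x
    ... | yes p = just p
    ... | no _  = nothing

  eval : Poly → ℚ → ℚ
  eval []      x = 0ℚ
  eval (a ∷ p) x = a + x * eval p x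

  eval-+P : ∀ p q x → eval (p +P q) x ≡ eval p x + eval q x
  eval-+P []      q       x = sym (+-identityˡ _)
  eval-+P (a ∷ p) []      x = sym (+-identityʳ _)
  eval-+P (a ∷ p) (b ∷ q) x rewrite eval-+P p q x = shuffle a b x (eval p x) (eval q x)
    where
    shuffle : ∀ a b x u v → (a + b) + x * (u + v) ≡ (a + x * u) + (b + x * v)
    shuffle = solve-∀ ℚ-ring

  eval-scaleP : ∀ a p x → eval (scaleP a p) x ≡ a * eval p x
  eval-scaleP a []      x = sym (*-zeroʳ a)
  eval-scaleP a (b ∷ p) x rewrite eval-scaleP a p x = distrib a b x (eval p x)
    where
    distrib : ∀ a b x u → a * b + x * (a * u) ≡ a * (b + x * u)
    distrib = solve-∀ ℚ-ring

  eval-*P : ∀ p q x → eval (p *P q) x ≡ eval p x * eval q x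
  eval-*P []      q x = sym (*-zeroˡ (eval q x))
  eval-*P (a ∷ p) q x
    rewrite eval-+P (scaleP a q) (0ℚ ∷ (p *P q)) x | eval-scaleP a q x | eval-*P p q x
    = distrib a x (eval p x) (eval q x)
    where
    distrib : ∀ a x u v → a * v + (0ℚ + x * (u * v)) ≡ (a + x * u) * v
    distrib = solve-∀ ℚ-ring

  eval-negP : ∀ p x → eval (negP p) x ≡ - eval p x
  eval-negP []      x = refl
  eval-negP (a ∷ p) x rewrite eval-negP p x = neg-distrib a x (eval p x)
    where
    neg-distrib : ∀ a x u → - a + x * (- u) ≡ - (a + x * u)
    neg-distrib = solve-∀ ℚ-ring

  eval-*P+*P : ∀ p q r s x → eval (p *P q +P r *P s) x ≡ eval p x * eval q x + eval r x * eval s x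
  eval-*P+*P p q r s x = trans (eval-+P (p *P q) (r *P s) x) (cong₂ _+_ (eval-*P p q x) (eval-*P r s x))

  eval-IsZeroP : ∀ {p} x → IsZeroP p → eval p x ≡ 0ℚ
  eval-IsZeroP x []             = refl
  eval-IsZeroP x (refl ∷ zeros) rewrite eval-IsZeroP x zeros | *-zeroʳ x = +-identityʳ 0ℚ

  eval-cross⇒root : ∀ p q r s x → eval p x * eval q x ≡ eval r x * eval s x →
                    eval (p *P q +P negP (r *P s)) x ≡ 0ℚ
  eval-cross⇒root p q r s x eq
    rewrite eval-+P (p *P q) (negP (r *P s)) x | eval-negP (r *P s) x
          | eval-*P p q x | eval-*P r s x | eq = +-inverseʳ (eval r x * eval s x)

  positive⇒¬IsZeroP : ∀ {p} x → 0ℚ < eval p x → ¬ IsZeroP p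
  positive⇒¬IsZeroP x 0<p[x] p≈0 = <-irrefl refl (subst (0ℚ <_) (eval-IsZeroP x p≈0) 0<p[x])

  deflate : ℚ → Poly → Poly
  deflate c []          = []
  deflate c (a ∷ [])    = []
  deflate c (a ∷ b ∷ p) = eval (b ∷ p) c ∷ deflate c (b ∷ p)

  eval-deflate : ∀ c p y → eval p y ≡ (y - c) * eval (deflate c p) y + eval p c
  eval-deflate c []          y = sym (trans (+-identityʳ _) (*-zeroʳ (y - c)))
  eval-deflate c (a ∷ [])    y = constant a y c
    where
    constant : ∀ a y c → a + y * 0ℚ ≡ (y - c) * 0ℚ + (a + c * 0ℚ)
    constant = solve-∀ ℚ-ring
  eval-deflate c (a ∷ b ∷ p) y rewrite eval-deflate c (b ∷ p) y =
    horner a y c (eval (deflate c (b ∷ p)) y) (eval (b ∷ p) c)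
    where
    horner : ∀ a y c u v → a + y * ((y - c) * u + v) ≡ (y - c) * (v + y * u) + (a + c * v)
    horner = solve-∀ ℚ-ring

  length-deflate : ∀ c a p → length (deflate c (a ∷ p)) ≡ length p
  length-deflate c a []      = refl
  length-deflate c a (b ∷ p) = cong suc (length-deflate c b p)

  *-cancelˡ-pos : ∀ {c u v} → 0ℚ < c → c * u ≡ c * v → u ≡ v
  *-cancelˡ-pos {c} {u} {v} 0<c cu≡cv = begin
    u                ≡⟨ sym (*-identityˡ u) ⟩
    1ℚ * u           ≡⟨ cong (_* u) (sym (*-inverseˡ c)) ⟩
    1/ c * c * u     ≡⟨ *-assoc (1/ c) c u ⟩
    1/ c * (c * u)   ≡⟨ cong (1/ c *_) cu≡cv ⟩
    1/ c * (c * v)   ≡⟨ *-assoc (1/ c) c v ⟨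
    1/ c * c * v     ≡⟨ cong (_* v) (*-inverseˡ c) ⟩
    1ℚ * v           ≡⟨ *-identityˡ v ⟩
    v                ∎
    where
    open ≡-Reasoning
    instance
      c≢0 : NonZero c
      c≢0 = pos⇒nonZero c {{positive 0<c}}

  VanishesFrom : ℚ → Poly → Set
  VanishesFrom c p = ∀ y → 0ℚ ≤ y → eval p (y + c) ≡ 0ℚ

  root-vanishesFrom : ∀ {c p} → VanishesFrom c p → eval p c ≡ 0ℚ
  root-vanishesFrom {c} {p} vanish = trans (cong (eval p) (sym (+-identityˡ c))) (vanish 0ℚ ≤-refl)

  deflate-vanishesFrom : ∀ c p → VanishesFrom c p → VanishesFrom (1ℚ + c) (deflate c p)
  deflate-vanishesFrom c p vanish y 0≤y = *-cancelˡ-pos 0<y+1 (begin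
    (y + 1ℚ) * q[y′]              ≡⟨ cong (_* q[y′]) (shift-back y c) ⟨
    (y′ - c) * q[y′]              ≡⟨ +-identityʳ ((y′ - c) * q[y′]) ⟨
    (y′ - c) * q[y′] + 0ℚ         ≡⟨ cong ((y′ - c) * q[y′] +_) (root-vanishesFrom {c} {p} vanish) ⟨
    (y′ - c) * q[y′] + eval p c   ≡⟨ eval-deflate c p y′ ⟨
    eval p y′                     ≡⟨ cong (eval p) (shift y c) ⟩
    eval p ((y + 1ℚ) + c)         ≡⟨ vanish (y + 1ℚ) (<⇒≤ 0<y+1) ⟩
    0ℚ                            ≡⟨ *-zeroʳ (y + 1ℚ) ⟨
    (y + 1ℚ) * 0ℚ                 ∎)
    where
    open ≡-Reasoning
    y′ = y + (1ℚ + c)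
    q[y′] = eval (deflate c p) y′
    0<y+1 : 0ℚ < y + 1ℚ
    0<y+1 = +-mono-≤-< 0≤y (positive⁻¹ 1ℚ)
    shift : ∀ y c → y + (1ℚ + c) ≡ (y + 1ℚ) + c
    shift = solve-∀ ℚ-ring
    shift-back : ∀ y c → y + (1ℚ + c) - c ≡ y + 1ℚ
    shift-back = solve-∀ ℚ-ring

  head≡0 : ∀ a c {u} → u ≡ 0ℚ → a + c * u ≡ 0ℚ → a ≡ 0ℚ
  head≡0 a c refl h rewrite *-zeroʳ c | +-identityʳ a = h

  IsZeroP-deflate : ∀ c p → IsZeroP (deflate c p) → eval p c ≡ 0ℚ → IsZeroP p
  IsZeroP-deflate c []          _                _      = []
  IsZeroP-deflate c (a ∷ [])    _                p[c]≡0 = head≡0 a c refl p[c]≡0 ∷ []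
  IsZeroP-deflate c (a ∷ b ∷ p) (q[c]≡0 ∷ zeros) p[c]≡0 =
    head≡0 a c q[c]≡0 p[c]≡0 ∷ IsZeroP-deflate c (b ∷ p) zeros q[c]≡0

  vanishesFrom⇒IsZeroP : ∀ c p → VanishesFrom c p → IsZeroP p
  vanishesFrom⇒IsZeroP c p = bounded (length p) c p ℕ.≤-refl
    where
    bounded : ∀ n c p → length p ℕ.≤ n → VanishesFrom c p → IsZeroP p
    bounded n       c []      _          _      = []
    bounded (suc n) c (a ∷ p) (s≤s |p|≤n) vanish =
      IsZeroP-deflate c (a ∷ p)
        (bounded n (1ℚ + c) (deflate c (a ∷ p))
          (subst (ℕ._≤ n) (sym (length-deflate c a p)) |p|≤n)
          (deflate-vanishesFrom c (a ∷ p) vanish))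
        (root-vanishesFrom {c} {a ∷ p} vanish)


module Values where
  open Polynomials

  open import Data.Rational using (ℚ; 0ℚ; 1ℚ; _+_; _*_; _<_; NonZero; 1/_; positive)
  open import Data.Rational.Properties
  open import Data.List using ([]; _∷_)
  open import Relation.Binary.PropositionalEquality
  open import Tactic.RingSolver using (solve)

  pos-+ : ∀ {a b} → 0ℚ < a → 0ℚ < b → 0ℚ < a + b
  pos-+ = +-mono-<

  pos-* : ∀ {a b} → 0ℚ < a → 0ℚ < b → 0ℚ < a * b
  pos-* {a} {b} 0<a 0<b = positive⁻¹ (a * b) {{pos*pos⇒pos a {{positive 0<a}} b {{positive 0<b}}}}

  cross-pos : ∀ {N D N′ D′} → 0ℚ < N → 0ℚ < D → 0ℚ < D′ → N * D′ ≡ N′ * D → 0ℚ < N′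
  cross-pos {N} {D} {N′} {D′} 0<N 0<D 0<D′ eq =
    subst (0ℚ <_) N′-def (pos-* (pos-* 0<N 0<D′) (positive⁻¹ (1/ D) {{1/pos⇒pos D {{positive 0<D}}}}))
    where
    instance
      D≢0 : NonZero D
      D≢0 = pos⇒nonZero D {{positive 0<D}}
    N′-def : N * D′ * 1/ D ≡ N′
    N′-def = begin
      N * D′ * 1/ D     ≡⟨ cong (_* 1/ D) eq ⟩
      N′ * D * 1/ D     ≡⟨ *-assoc N′ D (1/ D) ⟩
      N′ * (D * 1/ D)   ≡⟨ cong (N′ *_) (*-inverseʳ D) ⟩
      N′ * 1ℚ           ≡⟨ *-identityʳ N′ ⟩
      N′                ∎
      where open ≡-Reasoning

  record _∶_≍_∶_ (a b c d : ℚ) : Set where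
    constructor proportion
    field cross : a * d ≡ c * b
  open _∶_≍_∶_

  module _ {a₁ b₁ a₂ b₂ N₁ D₁ N₂ D₂ : ℚ} where
    open ≡-Reasoning

    +-proportion : a₁ ∶ b₁ ≍ N₁ ∶ D₁ → a₂ ∶ b₂ ≍ N₂ ∶ D₂ →
                   (a₁ * b₂ + a₂ * b₁) ∶ (b₁ * b₂) ≍ (N₁ * D₂ + N₂ * D₁) ∶ (D₁ * D₂)
    +-proportion (proportion h₁) (proportion h₂) = proportion (begin
      (a₁ * b₂ + a₂ * b₁) * (D₁ * D₂)              ≡⟨ solve (a₁ ∷ b₁ ∷ a₂ ∷ b₂ ∷ D₁ ∷ D₂ ∷ []) ℚ-ring ⟩
      a₁ * D₁ * (b₂ * D₂) + a₂ * D₂ * (b₁ * D₁)    ≡⟨ cong₂ (λ u v → u * (b₂ * D₂) + v * (b₁ * D₁)) h₁ h₂ ⟩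
      N₁ * b₁ * (b₂ * D₂) + N₂ * b₂ * (b₁ * D₁)    ≡⟨ solve (N₁ ∷ b₁ ∷ b₂ ∷ D₂ ∷ N₂ ∷ D₁ ∷ []) ℚ-ring ⟩
      (N₁ * D₂ + N₂ * D₁) * (b₁ * b₂)              ∎)

    *-proportion : a₁ ∶ b₁ ≍ N₁ ∶ D₁ → a₂ ∶ b₂ ≍ N₂ ∶ D₂ →
                   (a₁ * a₂) ∶ (b₁ * b₂) ≍ (N₁ * N₂) ∶ (D₁ * D₂)
    *-proportion (proportion h₁) (proportion h₂) = proportion (begin
      (a₁ * a₂) * (D₁ * D₂)     ≡⟨ solve (a₁ ∷ a₂ ∷ D₁ ∷ D₂ ∷ []) ℚ-ring ⟩
      (a₁ * D₁) * (a₂ * D₂)     ≡⟨ cong₂ _*_ h₁ h₂ ⟩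
      (N₁ * b₁) * (N₂ * b₂)     ≡⟨ solve (N₁ ∷ b₁ ∷ N₂ ∷ b₂ ∷ []) ℚ-ring ⟩
      (N₁ * N₂) * (b₁ * b₂)     ∎)

    /-proportion : a₁ ∶ b₁ ≍ N₁ ∶ D₁ → a₂ ∶ b₂ ≍ N₂ ∶ D₂ →
                   (a₁ * b₂) ∶ (b₁ * a₂) ≍ (N₁ * D₂) ∶ (D₁ * N₂)
    /-proportion (proportion h₁) (proportion h₂) = proportion (begin
      (a₁ * b₂) * (D₁ * N₂)     ≡⟨ solve (a₁ ∷ b₂ ∷ D₁ ∷ N₂ ∷ []) ℚ-ring ⟩
      (a₁ * D₁) * (N₂ * b₂)     ≡⟨ cong₂ _*_ h₁ (sym h₂) ⟩
      (N₁ * b₁) * (a₂ * D₂)     ≡⟨ solve (N₁ ∷ b₁ ∷ a₂ ∷ D₂ ∷ []) ℚ-ring ⟩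
      (N₁ * D₂) * (b₁ * a₂)     ∎)

  ≍-trans : ∀ {a b N D N′ D′} → 0ℚ < D → a ∶ b ≍ N ∶ D → N ∶ D ≍ N′ ∶ D′ → a ∶ b ≍ N′ ∶ D′
  ≍-trans {a} {b} {N} {D} {N′} {D′} 0<D (proportion h) (proportion e) = proportion (*-cancelˡ-pos 0<D (begin
    D * (a * D′)    ≡⟨ solve (D ∷ a ∷ D′ ∷ []) ℚ-ring ⟩
    (a * D) * D′    ≡⟨ cong (_* D′) h ⟩
    (N * b) * D′    ≡⟨ solve (N ∷ b ∷ D′ ∷ []) ℚ-ring ⟩
    (N * D′) * b    ≡⟨ cong (_* b) e ⟩
    (N′ * D) * b    ≡⟨ solve (N′ ∷ D ∷ b ∷ []) ℚ-ring ⟩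
    D * (N′ * b)    ∎))
    where open ≡-Reasoning

  ≍-cancel : ∀ {a b N D k} → 0ℚ < k → a ∶ b ≍ (k * N) ∶ (k * D) → a * D ≡ N * b
  ≍-cancel {a} {b} {N} {D} {k} 0<k (proportion eq) = *-cancelˡ-pos 0<k (begin
    k * (a * D)     ≡⟨ solve (k ∷ a ∷ D ∷ []) ℚ-ring ⟩
    a * (k * D)     ≡⟨ eq ⟩
    (k * N) * b     ≡⟨ solve (k ∷ N ∷ b ∷ []) ℚ-ring ⟩
    k * (N * b)     ∎)
    where open ≡-Reasoning

  module AtPoint (x : ℚ) where

    record Value (f : RatFun) (N D : ℚ) : Set where
      field
        num>0 : 0ℚ < eval (num f) x
        den>0 : 0ℚ < eval (den f) x
        N>0   : 0ℚ < N
        D>0   : 0ℚ < D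
        ratio : eval (num f) x ∶ eval (den f) x ≍ N ∶ D
    open Value public

    value : ∀ {f N D a b} → eval (num f) x ≡ a → eval (den f) x ≡ b →
            0ℚ < a → 0ℚ < b → 0ℚ < N → 0ℚ < D → a ∶ b ≍ N ∶ D → Value f N D
    value refl refl 0<a 0<b 0<N 0<D r = record
      { num>0 = 0<a ; den>0 = 0<b ; N>0 = 0<N ; D>0 = 0<D ; ratio = r }

    rescale : ∀ {f N D N′ D′} → Value f N D → N ∶ D ≍ N′ ∶ D′ → 0ℚ < D′ → Value f N′ D′
    rescale v r 0<D′ = record
      { num>0 = num>0 v ; den>0 = den>0 v
      ; N>0 = cross-pos (N>0 v) (D>0 v) 0<D′ (cross r) ; D>0 = 0<D′
      ; ratio = ≍-trans (D>0 v) (ratio v) r }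

    oneR-value : Value oneR 1ℚ 1ℚ
    oneR-value = value one one 0<1 0<1 0<1 0<1 (proportion refl)
      where
      one : eval (constP 1ℚ) x ≡ 1ℚ
      one = trans (cong (1ℚ +_) (*-zeroʳ x)) (+-identityʳ 1ℚ)
      0<1 = positive⁻¹ 1ℚ

    Value-cong : ∀ {f N D N′ D′} → Value f N D → N ≡ N′ → D ≡ D′ → Value f N′ D′
    Value-cong v refl refl = v

    +R-value : ∀ {f g N₁ D₁ N₂ D₂} → Value f N₁ D₁ → Value g N₂ D₂ →
               Value (f +R g) (N₁ * D₂ + N₂ * D₁) (D₁ * D₂)
    +R-value {f} {g} vf vg =
      value (eval-*P+*P (num f) (den g) (num g) (den f) x) (eval-*P (den f) (den g) x)
            (pos-+ (pos-* (num>0 vf) (den>0 vg)) (pos-* (num>0 vg) (den>0 vf)))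
            (pos-* (den>0 vf) (den>0 vg))
            (pos-+ (pos-* (N>0 vf) (D>0 vg)) (pos-* (N>0 vg) (D>0 vf)))
            (pos-* (D>0 vf) (D>0 vg))
            (+-proportion (ratio vf) (ratio vg))

    *R-value : ∀ {f g N₁ D₁ N₂ D₂} → Value f N₁ D₁ → Value g N₂ D₂ →
               Value (f *R g) (N₁ * N₂) (D₁ * D₂)
    *R-value {f} {g} vf vg =
      value (eval-*P (num f) (num g) x) (eval-*P (den f) (den g) x)
            (pos-* (num>0 vf) (num>0 vg)) (pos-* (den>0 vf) (den>0 vg))
            (pos-* (N>0 vf) (N>0 vg)) (pos-* (D>0 vf) (D>0 vg))
            (*-proportion (ratio vf) (ratio vg))

    /R-value : ∀ {f g N₁ D₁ N₂ D₂} → Value f N₁ D₁ → Value g N₂ D₂ →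
               Value (f /R g) (N₁ * D₂) (D₁ * N₂)
    /R-value {f} {g} vf vg =
      value (eval-*P (num f) (den g) x) (eval-*P (den f) (num g) x)
            (pos-* (num>0 vf) (den>0 vg)) (pos-* (den>0 vf) (num>0 vg))
            (pos-* (N>0 vf) (D>0 vg)) (pos-* (D>0 vf) (N>0 vg))
            (/-proportion (ratio vf) (ratio vg))

    ΔR-value : ∀ {a b c Na Da Nb Db Nc Dc} → Value a Na Da → Value b Nb Db → Value c Nc Dc →
               Value (ΔR a b c) (Na * Nb * Dc) (Na * Db * Dc + Nb * Da * Dc + Nc * Da * Db)
    ΔR-value {Na = Na} {Da} {Nb} {Db} {Nc} {Dc} va vb vc =
      rescale (/R-value (*R-value va vb) (+R-value (+R-value va vb) vc))
              (proportion (solve (Na ∷ Da ∷ Nb ∷ Db ∷ Nc ∷ Dc ∷ []) ℚ-ring))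
              (pos-+ (pos-+ (pos-* (pos-* (N>0 va) (D>0 vb)) (D>0 vc)) (pos-* (pos-* (N>0 vb) (D>0 va)) (D>0 vc)))
                     (pos-* (pos-* (N>0 vc) (D>0 va)) (D>0 vb)))

    YR-value : ∀ {a b c Na Da Nb Db Nc Dc} → Value a Na Da → Value b Nb Db → Value c Nc Dc →
               Value (YR a b c) (Na * Nb * Dc + Nb * Nc * Da + Nc * Na * Db) (Na * Db * Dc)
    YR-value {Na = Na} {Da} {Nb} {Db} {Nc} {Dc} va vb vc =
      rescale (/R-value (+R-value (+R-value (*R-value va vb) (*R-value vb vc)) (*R-value vc va)) va)
              (proportion (solve (Na ∷ Da ∷ Nb ∷ Db ∷ Nc ∷ Dc ∷ []) ℚ-ring))
              (pos-* (pos-* (N>0 va) (D>0 vb)) (D>0 vc))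


module Localisation where

  open import Data.Nat
  open import Data.Nat.Properties
  open import Data.Nat.Tactic.RingSolver using (solve-∀)
  open import Data.Bool using (false; if_then_else_)
  open import Relation.Binary.PropositionalEquality

  -- Labels near the left boundary and far from the other two: they depend on the position d
  -- in the row but not on the row.  reduceWedge is reduce with the right and bottom boundary
  -- cases removed.
  Wedge : Set
  Wedge = ℕ → Edge → RatFun

  apexW blW brW : Wedge → ℕ → RatFun
  apexW H d = ΔR (H d L) (H d R) (H d B)
  blW   H d = ΔR (H d L) (H d B) (H d R)
  brW   H d = ΔR (H d R) (H d B) (H d L)

  reduceWedge : Wedge → Wedge
  reduceWedge H d L = if d ≡ᵇ 1 then blW H 1 +R apexW H 1
                      else YR (brW H (d ∸ 1)) (apexW H d) (blW H d)
  reduceWedge H d R = YR (blW H (suc d)) (apexW H (suc d)) (brW H d)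
  reduceWedge H d B = YR (apexW H (suc d)) (blW H (suc d)) (brW H d)

  initWedge : Wedge
  initWedge d L = if d ≡ᵇ 1 then bdryX else oneR
  initWedge d R = oneR
  initWedge d B = oneR

  leftWedge : ℕ → Wedge
  leftWedge zero    = initWedge
  leftWedge (suc m) = reduceWedge (leftWedge m)

  depth : Edge → ℕ
  depth L = 0
  depth R = 0
  depth B = 1

  -- T agrees with H on T_{r,d} when the triangle is at least a positions left of the right
  -- boundary and above row c; the base edges of row c itself are excluded.
  Agree : ℕ → ℕ → Labelling → Wedge → Set
  Agree c a T H = ∀ r d e → 1 ≤ d → d + a ≤ r → r + depth e ≤ c → T r d e ≡ H d e

  Agree-mono : ∀ {c c′ a T H} → c ≤ c′ → Agree c′ a T H → Agree c a T H
  Agree-mono c≤c′ agree r d e 1≤d d+a≤r below = agree r d e 1≤d d+a≤r (≤-trans below c≤c′)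

  <⇒≡ᵇ-false : ∀ {m n} → m < n → (m ≡ᵇ n) ≡ false
  <⇒≡ᵇ-false {zero}  {suc n} _         = refl
  <⇒≡ᵇ-false {suc m} {suc n} (s≤s m<n) = <⇒≡ᵇ-false m<n

  ΔR-cong : ∀ {x x′ y y′ z z′} → x ≡ x′ → y ≡ y′ → z ≡ z′ → ΔR x y z ≡ ΔR x′ y′ z′
  ΔR-cong refl refl refl = refl

  YR-cong : ∀ {a a′ b b′ c c′} → a ≡ a′ → b ≡ b′ → c ≡ c′ → YR a b c ≡ YR a′ b′ c′
  YR-cong refl refl refl = refl

  module SpokesAgree (T : Labelling) (H : Wedge) {r d : ℕ} (same : ∀ e → T r d e ≡ H d e) where
    apex-agree : apexS T r d ≡ apexW H d
    apex-agree = ΔR-cong (same L) (same R) (same B)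

    bl-agree : blS T r d ≡ blW H d
    bl-agree = ΔR-cong (same L) (same B) (same R)

    br-agree : brS T r d ≡ brW H d
    br-agree = ΔR-cong (same R) (same B) (same L)

  agree-nearby : ∀ {c a T H r d} → Agree (2 + c) a T H → d + suc a ≤ r →
                 ∀ r′ d′ → 1 ≤ d′ → d′ ≤ suc d → r ≤ r′ → r′ ≤ suc c →
                 ∀ e → T r′ d′ e ≡ H d′ e
  agree-nearby {c} {a} {r = r} {d = d} agree d+1+a≤r r′ d′ 1≤d′ d′≤1+d r≤r′ r′≤1+c e =
    agree r′ d′ e 1≤d′ d′+a≤r′ (≤-trans (+-monoʳ-≤ r′ (depth≤1 e)) r′+1≤2+c)
    where
    depth≤1 : ∀ e → depth e ≤ 1
    depth≤1 L = z≤n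
    depth≤1 R = z≤n
    depth≤1 B = s≤s z≤n
    d′+a≤r′ : d′ + a ≤ r′
    d′+a≤r′ = begin
      d′ + a      ≤⟨ +-monoˡ-≤ a d′≤1+d ⟩
      suc d + a   ≡⟨ +-suc d a ⟨
      d + suc a   ≤⟨ d+1+a≤r ⟩
      r           ≤⟨ r≤r′ ⟩
      r′          ∎
      where open ≤-Reasoning
    r′+1≤2+c : r′ + 1 ≤ 2 + c
    r′+1≤2+c = subst (_≤ 2 + c) (+-comm 1 r′) (s≤s r′≤1+c)

  +suc⇒< : ∀ {d a r} → d + suc a ≤ r → d < r
  +suc⇒< {d} {a} {r} h = ≤-trans (s≤s (m≤m+n d a)) (subst (_≤ r) (+-suc d a) h)

  module _ {N c a : ℕ} {T : Labelling} {H : Wedge} (agree : Agree (2 + c) a T H) (2+c≤N : 2 + c ≤ N) where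
    open SpokesAgree T H

    reduce-agree : Agree c (suc a) (reduce N T) (reduceWedge H)
    reduce-agree r (suc zero) L _ h r≤c′ =
      cong₂ _+R_ (bl-agree (near r 1 ≤-refl (s≤s z≤n) ≤-refl (m≤n⇒m≤1+n r≤c)))
                 (apex-agree (near (suc r) 1 ≤-refl (s≤s z≤n) (n≤1+n r) (s≤s r≤c)))
      where
      near = agree-nearby {d = 1} agree h
      r≤c = subst (_≤ c) (+-identityʳ r) r≤c′
    reduce-agree r d@(suc (suc d-2)) L _ h r≤c′ =
      YR-cong (br-agree (near r (suc d-2) (s≤s z≤n) (m≤n⇒m≤1+n (n≤1+n _)) ≤-refl (m≤n⇒m≤1+n r≤c)))
              (apex-agree (near (suc r) d (s≤s z≤n) (n≤1+n d) (n≤1+n r) (s≤s r≤c)))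
              (bl-agree (near r d (s≤s z≤n) (n≤1+n d) ≤-refl (m≤n⇒m≤1+n r≤c)))
      where
      near = agree-nearby {d = d} agree h
      r≤c = subst (_≤ c) (+-identityʳ r) r≤c′
    reduce-agree r d R 1≤d h r≤c′ rewrite <⇒≡ᵇ-false (+suc⇒< {d} {a} {r} h) =
      YR-cong (bl-agree (near r (suc d) (s≤s z≤n) ≤-refl ≤-refl (m≤n⇒m≤1+n r≤c)))
              (apex-agree (near (suc r) (suc d) (s≤s z≤n) ≤-refl (n≤1+n r) (s≤s r≤c)))
              (br-agree (near r d 1≤d (n≤1+n d) ≤-refl (m≤n⇒m≤1+n r≤c)))
      where
      near = agree-nearby {d = d} agree h
      r≤c = subst (_≤ c) (+-identityʳ r) r≤c′
    reduce-agree r d B 1≤d h r+1≤c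
      rewrite <⇒≡ᵇ-false (≤-trans (s≤s (m≤n⇒m≤1+n (subst (_≤ c) (+-comm r 1) r+1≤c))) 2+c≤N) =
      YR-cong (apex-agree (near (2 + r) (suc d) (s≤s z≤n) ≤-refl (m≤n⇒m≤1+n (n≤1+n r)) (s≤s 1+r≤c)))
              (bl-agree (near (suc r) (suc d) (s≤s z≤n) ≤-refl (n≤1+n r) (m≤n⇒m≤1+n 1+r≤c)))
              (br-agree (near (suc r) d 1≤d (n≤1+n d) (n≤1+n r) (m≤n⇒m≤1+n 1+r≤c)))
      where
      near = agree-nearby {d = d} agree h
      1+r≤c = subst (_≤ c) (+-comm r 1) r+1≤c

  reduceN-agree : ∀ k {N c a m T} → Agree (2 * k + c) a T (leftWedge m) → 2 * k + c ≤ N →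
                  Agree c (a + k) (reduceN N k T) (leftWedge (m + k))
  reduceN-agree zero {a = a} {m} agree _
    rewrite +-identityʳ a | +-identityʳ m = agree
  reduceN-agree (suc k) {N} {c} {a} {m} {T} agree bound
    rewrite +-suc a k | +-suc m k =
    reduceN-agree k {m = suc m} (reduce-agree (subst (λ c′ → Agree c′ a T (leftWedge m)) (unfold k c) agree) bound′)
                    (m+n≤o⇒m≤o∸n (2 * k + c) (≤-trans (≤-reflexive (+-comm _ 1)) (≤-trans (n≤1+n _) bound′)))
    where
    unfold : ∀ k c → 2 * suc k + c ≡ 2 + (2 * k + c)
    unfold = solve-∀
    bound′ : 2 + (2 * k + c) ≤ N
    bound′ = subst (_≤ N) (unfold k c) bound

  initX-agree : ∀ n → Agree (n ∸ 1) 1 (initX n) initWedge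
  initX-agree n r d L _ _     _     = refl
  initX-agree n r d R _ d+1≤r _     rewrite <⇒≡ᵇ-false (subst (_≤ r) (+-comm d 1) d+1≤r) = refl
  initX-agree n r d B _ _     r+1≤c rewrite <⇒≡ᵇ-false (subst (_≤ n ∸ 1) (+-comm r 1) r+1≤c) = refl

  CX-row2 : ∀ t n → 4 * (2 + t) ∸ 2 ≤ n → CX n 2 (2 + t) ≡ leftWedge (suc t) (suc t) L
  CX-row2 t n bound =
    reduceN-agree (suc t) {m = 0} (Agree-mono within (initX-agree n)) within
                  (2 * (2 + t) ∸ 1) (suc t) L (s≤s z≤n) fits (≤-reflexive (+-identityʳ _))
    where
    row : 2 * (2 + t) ∸ 1 ≡ 3 + 2 * t
    row = cong (_∸ 1) (double t)
      where
      double : ∀ t → 2 * (2 + t) ≡ 4 + 2 * t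
      double = solve-∀
    fits : suc t + (1 + suc t) ≤ 2 * (2 + t) ∸ 1
    fits = ≤-reflexive (trans (diagonal t) (sym row))
      where
      diagonal : ∀ t → suc t + (1 + suc t) ≡ 3 + 2 * t
      diagonal = solve-∀
    within : 2 * suc t + (2 * (2 + t) ∸ 1) ≤ n ∸ 1
    within = subst (λ r → 2 * suc t + r ≤ n ∸ 1) (sym row) (m+n≤o⇒m≤o∸n _ (subst (_≤ n) sum bound))
      where
      total : ∀ t → 4 * (2 + t) ≡ 2 + (2 * suc t + (3 + 2 * t) + 1)
      total = solve-∀
      sum : 4 * (2 + t) ∸ 2 ≡ 2 * suc t + (3 + 2 * t) + 1
      sum = cong (_∸ 2) (total t)


module Coefficients where
  open Polynomials

  open import Data.Nat as ℕ using (ℕ; zero; suc)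
  import Data.Nat.Properties as ℕ
  import Data.Integer as ℤ
  import Data.Integer.Properties as ℤ
  open import Data.Rational using (ℚ; mkℚ; 0ℚ; 1ℚ; _+_; _*_; -_; _-_)
  open import Data.Rational.Properties
  import Data.Rational.Unnormalised as ℚᵘ
  import Data.Rational.Unnormalised.Properties as ℚᵘ
  open import Data.Nat.Coprimality using (1-coprimeTo; sym)
  open import Data.List using ([]; _∷_)
  open import Relation.Binary.PropositionalEquality hiding (sym)
  import Relation.Binary.PropositionalEquality as ≡
  open import Tactic.RingSolver using (solve)

  qℕ-canonical : ∀ n → qℕ n ≡ mkℚ (ℤ.+ n) 0 (sym (1-coprimeTo n))
  qℕ-canonical n = normalize-coprime (sym (1-coprimeTo n))

  qℕ-suc : ∀ n → qℕ (suc n) ≡ 1ℚ + qℕ n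
  qℕ-suc n rewrite qℕ-canonical n | qℕ-canonical (suc n) =
    toℚᵘ-injective (ℚᵘ.≃-trans (ℚᵘ.*≡* cross)
                               (ℚᵘ.≃-sym (toℚᵘ-homo-+ 1ℚ (mkℚ (ℤ.+ n) 0 (sym (1-coprimeTo n))))))
    where
    cross : ℤ.+ suc n ℤ.* ℤ.+ 1 ≡ (ℤ.+ 1 ℤ.* ℤ.+ 1 ℤ.+ ℤ.+ n ℤ.* ℤ.+ 1) ℤ.* ℤ.+ 1
    cross rewrite ℤ.*-identityʳ (ℤ.+ n) | ℤ.*-identityʳ (ℤ.+ suc n) = refl

  -- Abstract, so that rewriting with these equations does not unfold their proofs.
  abstract
    qℕ-2+ : ∀ k → qℕ (2 ℕ.+ k) ≡ qℕ k + qℕ 2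
    qℕ-2+ k = trans (qℕ-suc (suc k)) (trans (cong (1ℚ +_) (qℕ-suc k)) (shift (qℕ k)))
      where
      shift : ∀ u → 1ℚ + (1ℚ + u) ≡ u + qℕ 2
      shift u = solve (u ∷ []) ℚ-ring

    qℕ-2*-3+ : ∀ t → qℕ (2 ℕ.* (3 ℕ.+ t)) ≡ qℕ (2 ℕ.* (2 ℕ.+ t)) + qℕ 2
    qℕ-2*-3+ t = trans (cong qℕ (ℕ.*-suc 2 (2 ℕ.+ t))) (qℕ-2+ (2 ℕ.* (2 ℕ.+ t)))

  81^≡9^*9^ : ∀ t → powℚ (qℕ 81) t ≡ powℚ (qℕ 9) t * powℚ (qℕ 9) t
  81^≡9^*9^ zero    = refl
  81^≡9^*9^ (suc t) = trans (cong (qℕ 81 *_) (81^≡9^*9^ t)) (square (powℚ (qℕ 9) t))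
    where
    square : ∀ p → qℕ 81 * (p * p) ≡ (qℕ 9 * p) * (qℕ 9 * p)
    square p = solve (p ∷ []) ℚ-ring

  eval-numC2 : ∀ s x → eval (numC2 s) x ≡ c20 s - c21 s * x + c22 s * (x * x)
  eval-numC2 s x = horner (c20 s) (c21 s) (c22 s) x
    where
    horner : ∀ a b c x → a + x * (- b + x * (c + x * 0ℚ)) ≡ a - b * x + c * (x * x)
    horner a b c x = solve (a ∷ b ∷ c ∷ x ∷ []) ℚ-ring

  eval-denC2 : ∀ s x → let e = powℚ (qℕ 9) (s ℕ.∸ 2) * x - 1ℚ in eval (denC2 s) x ≡ e * e
  eval-denC2 s x = trans (eval-*P root root x) (cong₂ _*_ (linear p x) (linear p x))
    where
    p = powℚ (qℕ 9) (s ℕ.∸ 2)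
    root = - 1ℚ ∷ p ∷ []
    linear : ∀ p x → - 1ℚ + x * (p + x * 0ℚ) ≡ p * x - 1ℚ
    linear p x = solve (p ∷ x ∷ []) ℚ-ring

  numC2-base : ∀ x → qℕ 54 * ((x - 1ℚ) * (x - qℕ 3)) ≡ qℕ 81 * eval (numC2 2) x
  numC2-base x = ≡.sym (trans (cong (qℕ 81 *_) (eval-numC2 2 x)) (solve (x ∷ []) ℚ-ring))

  numC2-step : ∀ t x {q} → q ≡ qℕ 9 * (powℚ (qℕ 9) t * x) →
    qℕ 9 * (qℕ 6 * ((q - qℕ 3) * (q - 1ℚ)) + qℕ 2 * ((q - qℕ 3) * (q - qℕ 9)) + qℕ 81 * eval (numC2 (2 ℕ.+ t)) x)
      ≡ qℕ 81 * eval (numC2 (3 ℕ.+ t)) x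
  -- Generalising the atoms makes them variables for the ring solver.
  numC2-step t x refl
    rewrite qℕ-2*-3+ t | 81^≡9^*9^ t
    with powℚ (qℕ 9) t | qℕ (2 ℕ.* (2 ℕ.+ t))
  ... | p | n = solve (p ∷ n ∷ x ∷ []) ℚ-ring

  denC2-corner : ∀ t x {q} → q ≡ qℕ 9 * (powℚ (qℕ 9) t * x) →
    (q - qℕ 9) * (q - qℕ 9) ≡ qℕ 81 * eval (denC2 (2 ℕ.+ t)) x
  denC2-corner t x refl = trans (squared (powℚ (qℕ 9) t) x) (cong (qℕ 81 *_) (≡.sym (eval-denC2 (2 ℕ.+ t) x)))
    where
    squared : ∀ p x → (qℕ 9 * (p * x) - qℕ 9) * (qℕ 9 * (p * x) - qℕ 9)
                      ≡ qℕ 81 * ((p * x - 1ℚ) * (p * x - 1ℚ))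
    squared p x = solve (p ∷ x ∷ []) ℚ-ring



module WedgeValues (x : ℚ) where
  open Polynomials
  open Values
  open Localisation
  open Coefficients
  open import Data.Nat as ℕ using (ℕ; zero; suc; s≤s)
  import Data.Nat.Properties as ℕ
  open import Data.Rational using (ℚ; 0ℚ; 1ℚ; _+_; _*_; -_; _-_; _<_)
  open import Data.Rational.Properties using (positive⁻¹; *-identityˡ; *-assoc)
  open import Data.List using ([]; _∷_)
  open import Relation.Binary.PropositionalEquality
  open import Tactic.RingSolver using (solve)
  open AtPoint x

  record Ones (H : Wedge) (d : ℕ) : Set where
    constructor ones
    field one : ∀ e → Value (H d e) 1ℚ 1ℚ

  -- With q = 9^m x, the values of column m + 1 (Frontier) and of column m (Corner) of the
  -- left wedge after m reductions.
  record Frontier (H : Wedge) (d : ℕ) (q : ℚ) : Set where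
    field
      left  : Value (H d L) (q - qℕ 3) q
      right : Value (H d R) 1ℚ 1ℚ
      base  : Value (H d B) 1ℚ 1ℚ

  record Corner (H : Wedge) (d : ℕ) (q N : ℚ) : Set where
    field
      left  : Value (H d L) N ((q - qℕ 9) * (q - qℕ 9))
      right : Value (H d R) (q - qℕ 3) (q - qℕ 9)
      base  : Value (H d B) (q - qℕ 3) (q - qℕ 9)

  module _ {H : Wedge} {d : ℕ} (o : Ones H d) where
    open Ones o

    apex-ones : Value (apexW H d) 1ℚ (qℕ 3)
    apex-ones = ΔR-value (one L) (one R) (one B)

    bl-ones : Value (blW H d) 1ℚ (qℕ 3)
    bl-ones = ΔR-value (one L) (one B) (one R)

    br-ones : Value (brW H d) 1ℚ (qℕ 3)
    br-ones = ΔR-value (one R) (one B) (one L)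

  module _ {H : Wedge} {d : ℕ} {q : ℚ} (fr : Frontier H d q) where
    open Frontier fr

    apex-frontier : Value (apexW H d) (q - qℕ 3) (qℕ 3 * q - qℕ 3)
    apex-frontier = Value-cong (ΔR-value left right base) (solve (q ∷ []) ℚ-ring) (solve (q ∷ []) ℚ-ring)

    bl-frontier : Value (blW H d) (q - qℕ 3) (qℕ 3 * q - qℕ 3)
    bl-frontier = Value-cong (ΔR-value left base right) (solve (q ∷ []) ℚ-ring) (solve (q ∷ []) ℚ-ring)

    br-frontier : Value (brW H d) q (qℕ 3 * q - qℕ 3)
    br-frontier = Value-cong (ΔR-value right base left) (solve (q ∷ []) ℚ-ring) (solve (q ∷ []) ℚ-ring)

  YR-ones : ∀ {a b c} → Value a 1ℚ (qℕ 3) → Value b 1ℚ (qℕ 3) → Value c 1ℚ (qℕ 3) →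
            Value (YR a b c) 1ℚ 1ℚ
  YR-ones va vb vc = rescale (YR-value va vb vc) (proportion refl) (positive⁻¹ 1ℚ)

  module _ {H : Wedge} {d : ℕ} where
    reduceWedge-ones : Ones H (suc d) → Ones H (2 ℕ.+ d) → Ones H (3 ℕ.+ d) → Ones (reduceWedge H) (2 ℕ.+ d)
    reduceWedge-ones o₁ o₂ o₃ = ones λ where
      L → YR-ones (br-ones o₁) (apex-ones o₂) (bl-ones o₂)
      R → YR-ones (bl-ones o₃) (apex-ones o₃) (br-ones o₂)
      B → YR-ones (apex-ones o₃) (bl-ones o₃) (br-ones o₂)

    frontier-step : ∀ {q} → Frontier H (suc d) q → Ones H (2 ℕ.+ d) → Ones H (3 ℕ.+ d) →
                    Frontier (reduceWedge H) (2 ℕ.+ d) (qℕ 9 * q)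
    frontier-step {q} fr o₂ o₃ = record
      { left  = Value-cong (YR-value (br-frontier fr) (apex-ones o₂) (bl-ones o₂))
                           (solve (q ∷ []) ℚ-ring) (solve (q ∷ []) ℚ-ring)
      ; right = YR-ones (bl-ones o₃) (apex-ones o₃) (br-ones o₂)
      ; base  = YR-ones (apex-ones o₃) (bl-ones o₃) (br-ones o₂)
      }

    corner-right : ∀ {q} → Frontier H (suc d) q → Ones H (2 ℕ.+ d) →
                   Value (reduceWedge H (suc d) R) (qℕ 9 * q - qℕ 3) (qℕ 9 * q - qℕ 9)
    corner-right {q} fr o₂ = Value-cong (YR-value (bl-ones o₂) (apex-ones o₂) (br-frontier fr))
                                        (solve (q ∷ []) ℚ-ring) (solve (q ∷ []) ℚ-ring)

    corner-base : ∀ {q} → Frontier H (suc d) q → Ones H (2 ℕ.+ d) →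
                  Value (reduceWedge H (suc d) B) (qℕ 9 * q - qℕ 3) (qℕ 9 * q - qℕ 9)
    corner-base {q} fr o₂ = Value-cong (YR-value (apex-ones o₂) (bl-ones o₂) (br-frontier fr))
                                       (solve (q ∷ []) ℚ-ring) (solve (q ∷ []) ℚ-ring)

  [9q-9]²>0 : ∀ q → 0ℚ < qℕ 3 * q - qℕ 3 → 0ℚ < (qℕ 9 * q - qℕ 9) * (qℕ 9 * q - qℕ 9)
  [9q-9]²>0 q 0<3q-3 = subst (0ℚ <_) factor (pos-* three×3q-3 three×3q-3)
    where
    factor : (qℕ 3 * (qℕ 3 * q - qℕ 3)) * (qℕ 3 * (qℕ 3 * q - qℕ 3)) ≡ (qℕ 9 * q - qℕ 9) * (qℕ 9 * q - qℕ 9)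
    factor = solve (q ∷ []) ℚ-ring
    three×3q-3 : 0ℚ < qℕ 3 * (qℕ 3 * q - qℕ 3)
    three×3q-3 = pos-* (positive⁻¹ (qℕ 3)) 0<3q-3

  first-corner-left : ∀ {H q} → Frontier H 1 q →
                      Value (reduceWedge H 1 L) (qℕ 54 * ((q - 1ℚ) * (q - qℕ 3)))
                                                ((qℕ 9 * q - qℕ 9) * (qℕ 9 * q - qℕ 9))
  first-corner-left {q = q} fr =
    rescale (+R-value (bl-frontier fr) (apex-frontier fr))
            (proportion (solve (q ∷ []) ℚ-ring))
            ([9q-9]²>0 q (D>0 (apex-frontier fr)))

  corner-left-step : ∀ {H d q N} → Corner H (suc d) q N → Frontier H (2 ℕ.+ d) q →
                     Value (reduceWedge H (2 ℕ.+ d) L)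
                           (qℕ 9 * (qℕ 6 * ((q - qℕ 3) * (q - 1ℚ)) + qℕ 2 * ((q - qℕ 3) * (q - qℕ 9)) + N))
                           ((qℕ 9 * q - qℕ 9) * (qℕ 9 * q - qℕ 9))
  corner-left-step {q = q} {N} co fr =
    rescale (YR-value (ΔR-value right base left) (apex-frontier fr) (bl-frontier fr))
            (proportion (solve (q ∷ N ∷ []) ℚ-ring))
            ([9q-9]²>0 q (D>0 (apex-frontier fr)))
    where open Corner co

  initWedge-ones : ∀ d → 2 ℕ.≤ d → Ones initWedge d
  initWedge-ones (suc zero) (s≤s ())
  initWedge-ones (suc (suc d)) _ = ones λ where
    L → oneR-value
    R → oneR-value
    B → oneR-value

  scaled : ℕ → ℚ
  scaled zero    = x
  scaled (suc m) = qℕ 9 * scaled m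

  scaled≡9^*x : ∀ m → scaled m ≡ powℚ (qℕ 9) m * x
  scaled≡9^*x zero    = sym (*-identityˡ x)
  scaled≡9^*x (suc m) = trans (cong (qℕ 9 *_) (scaled≡9^*x m)) (sym (*-assoc (qℕ 9) (powℚ (qℕ 9) m) x))

  module _ (0<x-3 : 0ℚ < x - qℕ 3) where

    bdryX-value : Value bdryX (x - qℕ 3) x
    bdryX-value = value numerator denominator 0<x-3 0<x 0<x-3 0<x (proportion refl)
      where
      numerator : eval (num bdryX) x ≡ x - qℕ 3
      numerator = unfolded x
        where
        unfolded : ∀ x → (- qℕ 3 + 0ℚ) + x * (1ℚ + x * 0ℚ) ≡ x - qℕ 3
        unfolded x = solve (x ∷ []) ℚ-ring
      denominator : eval (den bdryX) x ≡ x
      denominator = unfolded x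
        where
        unfolded : ∀ x → 0ℚ + x * (1ℚ + x * 0ℚ) ≡ x
        unfolded x = solve (x ∷ []) ℚ-ring
      0<x : 0ℚ < x
      0<x = subst (0ℚ <_) x-3+3≡x (pos-+ 0<x-3 (positive⁻¹ (qℕ 3)))
        where
        x-3+3≡x : x - qℕ 3 + qℕ 3 ≡ x
        x-3+3≡x = solve (x ∷ []) ℚ-ring

    record Front (m : ℕ) : Set where
      field
        frontier : Frontier (leftWedge m) (suc m) (scaled m)
        beyond   : ∀ d → 2 ℕ.+ m ℕ.≤ d → Ones (leftWedge m) d

    front : ∀ m → Front m
    front zero = record
      { frontier = record { left = bdryX-value ; right = oneR-value ; base = oneR-value }
      ; beyond   = initWedge-ones }
    front (suc m) = record
      { frontier = frontier-step frontier (beyond (2 ℕ.+ m) ℕ.≤-refl) (beyond (3 ℕ.+ m) (ℕ.n≤1+n _))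
      ; beyond   = λ where
          (suc (suc d)) (s≤s (s≤s 1+m≤d)) →
            reduceWedge-ones (beyond (suc d) (s≤s 1+m≤d)) (beyond (2 ℕ.+ d) (ℕ.m≤n⇒m≤1+n (s≤s 1+m≤d)))
                             (beyond (3 ℕ.+ d) (ℕ.m≤n⇒m≤1+n (ℕ.m≤n⇒m≤1+n (s≤s 1+m≤d))))
      }
      where open Front (front m)

    corner : ∀ t → Corner (leftWedge (suc t)) (suc t) (scaled (suc t)) (qℕ 81 * eval (numC2 (2 ℕ.+ t)) x)
    corner zero = record
      { left  = Value-cong (first-corner-left frontier) (numC2-base x) refl
      ; right = corner-right frontier (beyond 2 ℕ.≤-refl)
      ; base  = corner-base frontier (beyond 2 ℕ.≤-refl)
      }
      where open Front (front 0)
    corner (suc t) = record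
      { left  = Value-cong (corner-left-step (corner t) frontier)
                           (numC2-step t x (cong (qℕ 9 *_) (scaled≡9^*x t))) refl
      ; right = corner-right frontier (beyond (3 ℕ.+ t) ℕ.≤-refl)
      ; base  = corner-base frontier (beyond (3 ℕ.+ t) ℕ.≤-refl)
      }
      where open Front (front (suc t))

    row2-value : ∀ t → Value (leftWedge (suc t) (suc t) L)
                             (qℕ 81 * eval (numC2 (2 ℕ.+ t)) x) (qℕ 81 * eval (denC2 (2 ℕ.+ t)) x)
    row2-value t = Value-cong (Corner.left (corner t)) refl (denC2-corner t x (cong (qℕ 9 *_) (scaled≡9^*x t)))


module RowTwo where
  open Polynomials
  open Values
  open Localisation

  open import Data.Nat as ℕ using (suc)
  open import Data.Rational using (0ℚ; 1ℚ; _+_; _-_; _<_) renaming (_≤_ to _≤ℚ_; _*_ to _*ℚ_)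
  open import Data.Rational.Properties using (+-mono-≤-<; positive⁻¹; <-irrefl; +-inverseʳ; ≤-reflexive)
  open import Data.List using ([]; _∷_)
  open import Data.Product using (_×_; _,_)
  open import Relation.Nullary using (¬_)
  open import Relation.Binary.PropositionalEquality
  open import Tactic.RingSolver using (solve)

  row2-identity : ∀ t → let f = leftWedge (suc t) (suc t) L ; s = 2 ℕ.+ t in
    ¬ IsZeroP (den f) × num f *P denC2 s ≈P numC2 s *P den f
  row2-identity t = positive⇒¬IsZeroP (0ℚ + qℕ 4) (den>0 (value-at 0ℚ (≤-reflexive refl))) ,
                    vanishesFrom⇒IsZeroP (qℕ 4) _ vanishes
    where
    open AtPoint using (den>0; ratio)
    f = leftWedge (suc t) (suc t) L
    s = 2 ℕ.+ t
    point : ∀ y → 0ℚ ≤ℚ y → 0ℚ < y + qℕ 4 - qℕ 3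
    point y 0≤y = subst (0ℚ <_) shift (+-mono-≤-< 0≤y (positive⁻¹ 1ℚ))
      where
      shift : y + 1ℚ ≡ y + qℕ 4 - qℕ 3
      shift = solve (y ∷ []) ℚ-ring
    value-at : ∀ y → 0ℚ ≤ℚ y → let x = y + qℕ 4 in
               AtPoint.Value x f (qℕ 81 *ℚ eval (numC2 s) x) (qℕ 81 *ℚ eval (denC2 s) x)
    value-at y 0≤y = WedgeValues.row2-value (y + qℕ 4) (point y 0≤y) t
    vanishes : VanishesFrom (qℕ 4) (num f *P denC2 s +P negP (numC2 s *P den f))
    vanishes y 0≤y = eval-cross⇒root (num f) (denC2 s) (numC2 s) (den f) (y + qℕ 4)
                       (≍-cancel {N = eval (numC2 s) (y + qℕ 4)} {eval (denC2 s) (y + qℕ 4)} (positive⁻¹ (qℕ 81))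
                         (ratio (value-at y 0≤y)))


open Localisation using (CX-row2)
open RowTwo using (row2-identity)
open import Data.Nat using (ℕ; _≤_; _*_; _∸_)
open import Data.Product using (_×_)
open import Relation.Nullary using (¬_)
open import Data.Nat using (suc; s≤s; z≤n)
open import Relation.Binary.PropositionalEquality using (subst; sym)

corollary4p6 : (s n : ℕ) → 2 ≤ s → 4 * s ∸ 2 ≤ n →
    ¬ IsZeroP (den (CX n 2 s)) ×
    num (CX n 2 s) *P denC2 s ≈P numC2 s *P den (CX n 2 s)
corollary4p6 (suc (suc t)) n (s≤s (s≤s z≤n)) bound =
  subst (λ f → ¬ IsZeroP (den f) × num f *P denC2 (suc (suc t)) ≈P numC2 (suc (suc t)) *P den f)
        (sym (CX-row2 t n bound)) (row2-identity t)
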